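{- Let $q$ be a prime power, $n=tt'$ with $t,t'\in\mathbb{N}$, and $s\in\mathbb{N}$ with $\gcd(s,t)=1$. For any polynomial $f(x)=\sum_{i=0}^{t'-1}a_ix^{q^{it+s}}\in\mathbb{F}_{q^n}[x]$, \[\mathcal{G}(f)\supseteq\left\{\begin{pmatrix}a&0\\0&a^{q^s}\end{pmatrix}: a\in\mathbb{F}_{q^t}^*\right\}.\] In particular, $|\mathcal{G}(f)|\geq q^t-1$.
   Context: For an $\mathbb{F}_q$-linearized polynomial $f(x)\in\mathbb{F}_{q^n}[x]$, its linear automorphism group is $\mathcal{G}(f)=\{A\in\mathrm{GL}(2,q^n): \forall x\in\mathbb{F}_{q^n}\ \exists y\in\mathbb{F}_{q^n} \text{ with } A(x,f(x))^T=(y,f(y))^T\}$. -}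

module Defs where

open import Level using (Level; _⊔_)
open import Data.Nat as ℕ using (ℕ; zero; suc; _∸_)
open import Data.Nat.Primality using (Prime)
open import Data.Fin as Fin using (Fin)
open import Data.List using (List; length)
open import Data.List.Relation.Unary.All using (All)
open import Data.List.Relation.Unary.AllPairs using (AllPairs)
open import Data.Product using (Σ; ∃; _×_; _,_)
open import Relation.Binary.PropositionalEquality using (_≡_)
open import Relation.Nullary using (¬_)
open import Algebra.Bundles using (CommutativeRing)

IsPrimePower : ℕ → Set
IsPrimePower q = Σ ℕ λ p → Σ ℕ λ k → Prime p × (1 ℕ.≤ k) × (q ≡ p ℕ.^ k)

record IsField {c ℓ} (R : CommutativeRing c ℓ) : Set (c ⊔ ℓ) where
  open CommutativeRing R
  field
    0≉1     : ¬ (0# ≈ 1#)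
    inverse : ∀ x → ¬ (x ≈ 0#) → Σ Carrier λ y → (x * y) ≈ 1#

HasCardinality : ∀ {c ℓ} (R : CommutativeRing c ℓ) → ℕ → Set (c ⊔ ℓ)
HasCardinality R N =
  Σ (Fin N → Carrier) λ e →
    (∀ i j → e i ≈ e j → i ≡ j) × (∀ x → Σ (Fin N) λ i → e i ≈ x)
  where open CommutativeRing R

record FiniteField c ℓ (N : ℕ) : Set (Level.suc (c ⊔ ℓ)) where
  field
    cring   : CommutativeRing c ℓ
    isField : IsField cring
    card    : HasCardinality cring N
  open CommutativeRing cring public

module _ {c ℓ} {N : ℕ} (F : FiniteField c ℓ N) where
  open FiniteField F

  pow : Carrier → ℕ → Carrier
  pow x zero    = 1#
  pow x (suc m) = x * pow x m

  sumFin : (m : ℕ) → (Fin m → Carrier) → Carrier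
  sumFin zero    g = 0#
  sumFin (suc m) g = g Fin.zero + sumFin m (λ i → g (Fin.suc i))

  record M2 : Set c where
    constructor mat
    field
      m11 m12 m21 m22 : Carrier

  _≈M_ : M2 → M2 → Set ℓ
  mat a b c' d ≈M mat a' b' c'' d' = (a ≈ a') × (b ≈ b') × (c' ≈ c'') × (d ≈ d')

  det : M2 → Carrier
  det (mat a b c' d) = (a * d) - (b * c')

  InGL2 : M2 → Set ℓ
  InGL2 A = ¬ (det A ≈ 0#)

  InG : (Carrier → Carrier) → M2 → Set (c ⊔ ℓ)
  InG f A@(mat a b c' d) =
    InGL2 A × (∀ x → Σ Carrier λ y → ((a * x) + (b * f x) ≈ y) × ((c' * x) + (d * f x) ≈ f y))

  diag : Carrier → Carrier → M2
  diag a b = mat a 0# 0# b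

  -- |𝒢(f)| ≥ m : there are m pairwise distinct matrices in 𝒢(f)
  AtLeastInG : (Carrier → Carrier) → ℕ → Set (c ⊔ ℓ)
  AtLeastInG f m =
    Σ (List M2) λ L → (length L ≡ m) × AllPairs (λ A B → ¬ (A ≈M B)) L × All (InG f) L

  linPoly : (q t t' s : ℕ) → (Fin t' → Carrier) → Carrier → Carrier
  linPoly q t t' s coeffs x = sumFin t' (λ i → coeffs i * pow x (q ℕ.^ ((Fin.toℕ i ℕ.* t) ℕ.+ s)))

-- For a in 𝔽_{q^t} we have a ^ q ^ (i t + s) = a ^ q ^ s for every i, so f (a x) = a ^ q ^ s · f x
-- and diag(a, a ^ q ^ s) maps the graph of f onto itself.
-- For the count, write Q = q ^ t and q ^ n − 1 = (Q − 1) e. By Fermat every unit b has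
-- (b ^ (Q − 1)) ^ e = 1, so a unit with b ^ (Q − 1) ≠ 1 is a root of Σ_{j<e} x ^ ((Q − 1) j),
-- a polynomial of degree (Q − 1)(e − 1). Hence at most (Q − 1)(e − 1) of the q ^ n − 1 units
-- lie outside 𝔽_Q, and at least Q − 1 lie inside.
module Submission where

open import Defs
open import Algebra.Bundles using (CommutativeMonoid; CommutativeRing)
open import Data.Nat as ℕ using (ℕ; zero; suc; _≤_; z≤n; s≤s)
open import Data.Nat.GCD using (gcd)
open import Data.Fin as Fin using (Fin)
open import Data.List using (List; []; _∷_; length; map; foldr; filter; take; replicate; _++_; tabulate)
open import Data.List.Relation.Unary.All as All using (All; []; _∷_)
open import Data.List.Relation.Unary.Any using (here; there)
open import Data.List.Relation.Unary.AllPairs using ([]; _∷_)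
open import Data.Bool using (true; false)
open import Data.Maybe using (nothing)
open import Data.Product using (Σ; ∃; _×_; _,_; proj₁; proj₂)
open import Data.Empty using (⊥-elim)
open import Relation.Binary.PropositionalEquality as ≡ using (_≡_)
open import Relation.Nullary using (¬_; Dec; yes; no; does)
open import Relation.Unary using (Pred; Decidable)
open import Relation.Unary.Properties using (∁?)
open import Tactic.RingSolver.Core.AlmostCommutativeRing using (fromCommutativeRing)
open import Tactic.RingSolver.Core.Expression using (_⊕_; _⊗_; Κ)

import Data.Nat.Properties as ℕ
import Data.List.Properties as List
import Data.List.Relation.Unary.All.Properties as All
import Data.List.Relation.Unary.AllPairs as AllPairs
import Data.List.Relation.Unary.AllPairs.Properties as AllPairs
import Data.List.Relation.Unary.Unique.Setoid as UniqueSetoid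
import Data.List.Relation.Unary.Unique.Setoid.Properties as Unique
import Data.List.Membership.Setoid as MembershipSetoid
import Data.List.Membership.Setoid.Properties as Membership

length-filter+length-filter-∁ : ∀ {a p} {A : Set a} {P : Pred A p} (P? : Decidable P) (xs : List A) →
                                length (filter P? xs) ℕ.+ length (filter (∁? P?) xs) ≡ length xs
length-filter+length-filter-∁ P? []       = ≡.refl
length-filter+length-filter-∁ P? (x ∷ xs) with does (P? x)
... | true  = ≡.cong suc (length-filter+length-filter-∁ P? xs)
... | false = ≡.trans (ℕ.+-suc _ _) (≡.cong suc (length-filter+length-filter-∁ P? xs))

suc^≡suc-* : ∀ d k → ∃ λ e → suc d ℕ.^ k ≡ suc (d ℕ.* e)
suc^≡suc-* d zero    = 0 , ≡.cong suc (≡.sym (ℕ.*-zeroʳ d))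
suc^≡suc-* d (suc k) with suc^≡suc-* d k
... | e , eq = suc (e ℕ.+ d ℕ.* e) , ≡.trans (≡.cong (suc d ℕ.*_) eq) (expand d e)
  where
  open import Data.Nat using (_+_; _*_)
  open import Data.Nat.Tactic.RingSolver using (solve-∀)
  expand : ∀ d e → suc d * suc (d * e) ≡ suc (d * suc (e + d * e))
  expand = solve-∀

m+n≡o+p∧n≤p⇒o≤m : ∀ {m n o p} → m ℕ.+ n ≡ o ℕ.+ p → n ≤ p → o ≤ m
m+n≡o+p∧n≤p⇒o≤m {m} {n} {o} {p} eq n≤p = ℕ.+-cancelʳ-≤ p o m (begin
  o ℕ.+ p   ≡⟨ ≡.sym eq ⟩
  m ℕ.+ n   ≤⟨ ℕ.+-monoʳ-≤ m n≤p ⟩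
  m ℕ.+ p   ∎)
  where open ℕ.≤-Reasoning

module ListProduct {c ℓ} (M : CommutativeMonoid c ℓ) where
  open CommutativeMonoid M
  open MembershipSetoid setoid using (_∈_; _─_)
  open UniqueSetoid setoid using (Unique)
  open import Relation.Binary.Reasoning.Setoid setoid

  prod : List Carrier → Carrier
  prod = foldr _∙_ ε

  prod-─ : ∀ {x ys} (x∈ys : x ∈ ys) → prod ys ≈ x ∙ prod (ys ─ x∈ys)
  prod-─ (here x≈y)             = ∙-congʳ (sym x≈y)
  prod-─ {x} {y ∷ ys} (there p) = begin
    y ∙ prod ys                ≈⟨ ∙-congˡ (prod-─ p) ⟩
    y ∙ (x ∙ prod (ys ─ p))    ≈⟨ sym (assoc y x _) ⟩
    (y ∙ x) ∙ prod (ys ─ p)    ≈⟨ ∙-congʳ (comm y x) ⟩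
    (x ∙ y) ∙ prod (ys ─ p)    ≈⟨ assoc x y _ ⟩
    x ∙ (y ∙ prod (ys ─ p))    ∎

  ∈-─ : ∀ {x z ys} (x∈ys : x ∈ ys) → z ∈ ys → z ≉ x → z ∈ ys ─ x∈ys
  ∈-─ (here x≈y) (here z≈y) z≉x = ⊥-elim (z≉x (trans z≈y (sym x≈y)))
  ∈-─ (here _)   (there z∈ys) _ = z∈ys
  ∈-─ (there _)  (here z≈y)   _ = here z≈y
  ∈-─ (there p)  (there z∈ys) z≉x = there (∈-─ p z∈ys z≉x)

  prod-unique-⊆ : ∀ {xs ys} → Unique xs → All (_∈ ys) xs → length xs ≡ length ys → prod xs ≈ prod ys
  prod-unique-⊆ {[]}     {[]} _ _ _ = refl
  prod-unique-⊆ {x ∷ xs} {ys} (x≉xs ∷ uniq) (x∈ys ∷ xs⊆ys) |xs|≡|ys| = begin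
    x ∙ prod xs            ≈⟨ ∙-congˡ (prod-unique-⊆ uniq xs⊆ys─x |xs|≡|ys─x|) ⟩
    x ∙ prod (ys ─ x∈ys)   ≈⟨ sym (prod-─ x∈ys) ⟩
    prod ys                ∎
    where
    xs⊆ys─x : All (_∈ ys ─ x∈ys) xs
    xs⊆ys─x = All.zipWith (λ (x≉z , z∈ys) → ∈-─ x∈ys z∈ys (λ z≈x → x≉z (sym z≈x))) (x≉xs , xs⊆ys)
    |xs|≡|ys─x| : length xs ≡ length (ys ─ x∈ys)
    |xs|≡|ys─x| = ≡.cong ℕ.pred (≡.trans |xs|≡|ys| (List.length-removeAt′ ys _))

module FieldTheory {c ℓ} (R : CommutativeRing c ℓ) (R-isField : IsField R) where
  open CommutativeRing R
  open IsField R-isField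
  open import Algebra.Properties.Semiring.Exp semiring public using (_^_; ^-congˡ; ^-congʳ; ^-assocʳ)
  open import Algebra.Properties.CommutativeSemiring.Exp commutativeSemiring public using (^-distrib-*)
  open import Algebra.Properties.Group +-group using (x∙y⁻¹≈ε⇒x≈y; x≈y⇒x∙y⁻¹≈ε)
  open import Algebra.Properties.Ring ring using ([y-z]x≈yx-zx)
  open import Tactic.RingSolver.NonReflective (fromCommutativeRing R (λ _ → nothing)) using (solve; _⊜_)
  open ListProduct *-commutativeMonoid public
  open UniqueSetoid setoid using (Unique)
  open import Relation.Binary.Reasoning.Setoid setoid

  1≉0 : 1# ≉ 0#
  1≉0 1≈0 = 0≉1 (sym 1≈0)

  *-cancelʳ-≉0 : ∀ {x y z} → z ≉ 0# → x * z ≈ y * z → x ≈ y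
  *-cancelʳ-≉0 {x} {y} {z} z≉0 xz≈yz with inverse z z≉0
  ... | z⁻¹ , zz⁻¹≈1 = begin
    x               ≈⟨ sym (*-identityʳ x) ⟩
    x * 1#          ≈⟨ *-congˡ (sym zz⁻¹≈1) ⟩
    x * (z * z⁻¹)   ≈⟨ sym (*-assoc x z z⁻¹) ⟩
    (x * z) * z⁻¹   ≈⟨ *-congʳ xz≈yz ⟩
    (y * z) * z⁻¹   ≈⟨ *-assoc y z z⁻¹ ⟩
    y * (z * z⁻¹)   ≈⟨ *-congˡ zz⁻¹≈1 ⟩
    y * 1#          ≈⟨ *-identityʳ y ⟩
    y               ∎

  *-cancelˡ-≉0 : ∀ {x y z} → z ≉ 0# → z * x ≈ z * y → x ≈ y
  *-cancelˡ-≉0 {x} {y} {z} z≉0 zx≈zy = *-cancelʳ-≉0 z≉0 (trans (*-comm x z) (trans zx≈zy (*-comm z y)))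

  ≉0∧*≈0⇒≈0 : ∀ {x y} → x ≉ 0# → x * y ≈ 0# → y ≈ 0#
  ≉0∧*≈0⇒≈0 {x} {y} x≉0 xy≈0 = *-cancelˡ-≉0 x≉0 (trans xy≈0 (sym (zeroʳ x)))

  xz≈yz∧x≉y⇒z≈0 : ∀ {x y z} → x ≉ y → x * z ≈ y * z → z ≈ 0#
  xz≈yz∧x≉y⇒z≈0 {x} {y} {z} x≉y xz≈yz =
    ≉0∧*≈0⇒≈0 (λ x-y≈0 → x≉y (x∙y⁻¹≈ε⇒x≈y x y x-y≈0)) (trans ([y-z]x≈yx-zx z x y) (x≈y⇒x∙y⁻¹≈ε xz≈yz))

  *-≉0 : ∀ {x y} → x ≉ 0# → y ≉ 0# → x * y ≉ 0#
  *-≉0 x≉0 y≉0 xy≈0 = y≉0 (≉0∧*≈0⇒≈0 x≉0 xy≈0)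

  ^-≉0 : ∀ {x} n → x ≉ 0# → x ^ n ≉ 0#
  ^-≉0 zero    _       = 1≉0
  ^-≉0 (suc n) x≉0     = *-≉0 x≉0 (^-≉0 n x≉0)

  prod-≉0 : ∀ {xs} → All (_≉ 0#) xs → prod xs ≉ 0#
  prod-≉0 []                 = 1≉0
  prod-≉0 (x≉0 ∷ xs≉0)       = *-≉0 x≉0 (prod-≉0 xs≉0)

  prod-map-* : ∀ b xs → prod (map (b *_) xs) ≈ b ^ length xs * prod xs
  prod-map-* b []       = sym (*-identityˡ 1#)
  prod-map-* b (x ∷ xs) = trans (*-congˡ (prod-map-* b xs))
    (solve 4 (λ b x B P → ((b ⊗ x) ⊗ (B ⊗ P)) ⊜ ((b ⊗ B) ⊗ (x ⊗ P))) refl b x (b ^ length xs) (prod xs))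

  -- A coefficient list cs (lowest degree first) stands for the monic polynomial of degree
  -- length cs with these lower coefficients; being monic, it is never zero, so roots-bound
  -- needs no side condition.
  eval : List Carrier → Carrier → Carrier
  eval []       x = 1#
  eval (a ∷ cs) x = a + x * eval cs x

  quotient : Carrier → List Carrier → List Carrier
  quotient r []       = []
  quotient r (a ∷ cs) = eval (a ∷ cs) r ∷ quotient r cs

  length-quotient : ∀ r cs → length (quotient r cs) ≡ length cs
  length-quotient r []       = ≡.refl
  length-quotient r (_ ∷ cs) = ≡.cong suc (length-quotient r cs)

  eval-quotient : ∀ a cs x r → eval (a ∷ cs) x + r * eval (quotient r cs) x ≈ x * eval (quotient r cs) x + eval (a ∷ cs) r
  eval-quotient a [] x r =
    solve 3 (λ a x r → ((a ⊕ x ⊗ Κ 1#) ⊕ r ⊗ Κ 1#) ⊜ (x ⊗ Κ 1# ⊕ (a ⊕ r ⊗ Κ 1#))) refl a x r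
  eval-quotient a (b ∷ cs) x r = begin
    (a + x * P) + r * (Pr + x * Q)   ≈⟨ solve 6 (λ a x r P Pr Q → ((a ⊕ x ⊗ P) ⊕ r ⊗ (Pr ⊕ x ⊗ Q)) ⊜ ((a ⊕ r ⊗ Pr) ⊕ x ⊗ (P ⊕ r ⊗ Q))) refl a x r P Pr Q ⟩
    (a + r * Pr) + x * (P + r * Q)   ≈⟨ +-congˡ (*-congˡ (eval-quotient b cs x r)) ⟩
    (a + r * Pr) + x * (x * Q + Pr)  ≈⟨ solve 5 (λ a x r Pr Q → ((a ⊕ r ⊗ Pr) ⊕ x ⊗ (x ⊗ Q ⊕ Pr)) ⊜ (x ⊗ (Pr ⊕ x ⊗ Q) ⊕ (a ⊕ r ⊗ Pr))) refl a x r Pr Q ⟩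
    x * (Pr + x * Q) + (a + r * Pr)  ∎
    where
    P Pr Q : Carrier
    P  = eval (b ∷ cs) x
    Pr = eval (b ∷ cs) r
    Q  = eval (quotient r cs) x

  roots-bound : ∀ cs {rs} → Unique rs → All (λ r → eval cs r ≈ 0#) rs → length rs ≤ length cs
  roots-bound cs        {[]}     _             _                = z≤n
  roots-bound []        {r ∷ _}  _             (1≈0 ∷ _)        = ⊥-elim (1≉0 1≈0)
  roots-bound (a ∷ cs)  {r ∷ rs} (r≉rs ∷ uniq) (r-root ∷ roots) =
    s≤s (≡.subst (length rs ≤_) (length-quotient r cs)
                 (roots-bound (quotient r cs) uniq (All.zipWith quotient-root (r≉rs , roots))))
    where
    quotient-root : ∀ {z} → (r ≉ z × eval (a ∷ cs) z ≈ 0#) → eval (quotient r cs) z ≈ 0#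
    quotient-root {z} (r≉z , z-root) = xz≈yz∧x≉y⇒z≈0 r≉z (begin
      r * Q                    ≈⟨ sym (+-identityˡ _) ⟩
      0# + r * Q               ≈⟨ +-congʳ (sym z-root) ⟩
      eval (a ∷ cs) z + r * Q  ≈⟨ eval-quotient a cs z r ⟩
      z * Q + eval (a ∷ cs) r  ≈⟨ +-congˡ r-root ⟩
      z * Q + 0#               ≈⟨ +-identityʳ _ ⟩
      z * Q                    ∎)
      where
      Q : Carrier
      Q = eval (quotient r cs) z

  eval-replicate-0 : ∀ k cs x → eval (replicate k 0# ++ cs) x ≈ x ^ k * eval cs x
  eval-replicate-0 zero    cs x = sym (*-identityˡ _)
  eval-replicate-0 (suc k) cs x = begin
    0# + x * eval (replicate k 0# ++ cs) x   ≈⟨ +-identityˡ _ ⟩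
    x * eval (replicate k 0# ++ cs) x        ≈⟨ *-congˡ (eval-replicate-0 k cs x) ⟩
    x * (x ^ k * eval cs x)                  ≈⟨ sym (*-assoc x _ _) ⟩
    (x * x ^ k) * eval cs x                  ∎

  -- geometric p m stands for 1 + y + ⋯ + y ^ m with y = x ^ suc p.
  geometric : ℕ → ℕ → List Carrier
  geometric p zero    = []
  geometric p (suc m) = 1# ∷ replicate p 0# ++ geometric p m

  length-geometric : ∀ p m → length (geometric p m) ≡ suc p ℕ.* m
  length-geometric p zero    = ≡.sym (ℕ.*-zeroʳ p)
  length-geometric p (suc m) = ≡.trans
    (≡.cong suc (≡.trans (List.length-++ (replicate p 0#))
                         (≡.cong₂ ℕ._+_ (List.length-replicate p) (length-geometric p m))))
    (≡.sym (ℕ.*-suc (suc p) m))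

  eval-geometric-suc : ∀ p m x → eval (geometric p (suc m)) x ≈ 1# + x ^ suc p * eval (geometric p m) x
  eval-geometric-suc p m x = +-congˡ (begin
    x * eval (replicate p 0# ++ geometric p m) x   ≈⟨ *-congˡ (eval-replicate-0 p (geometric p m) x) ⟩
    x * (x ^ p * eval (geometric p m) x)           ≈⟨ sym (*-assoc x _ _) ⟩
    (x * x ^ p) * eval (geometric p m) x           ∎)

  geometric-sum : ∀ p m x → let y = x ^ suc p in y * eval (geometric p m) x + 1# ≈ y ^ suc m + eval (geometric p m) x
  geometric-sum p zero    x = refl
  geometric-sum p (suc m) x = begin
    y * G′ + 1#                    ≈⟨ +-congʳ (*-congˡ (eval-geometric-suc p m x)) ⟩
    y * (1# + y * G) + 1#          ≈⟨ solve 2 (λ y G → (y ⊗ (Κ 1# ⊕ y ⊗ G) ⊕ Κ 1#) ⊜ (y ⊗ (y ⊗ G ⊕ Κ 1#) ⊕ Κ 1#)) refl y G ⟩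
    y * (y * G + 1#) + 1#          ≈⟨ +-congʳ (*-congˡ (geometric-sum p m x)) ⟩
    y * (y ^ suc m + G) + 1#       ≈⟨ solve 3 (λ y Y G → (y ⊗ (Y ⊕ G) ⊕ Κ 1#) ⊜ (y ⊗ Y ⊕ (Κ 1# ⊕ y ⊗ G))) refl y (y ^ suc m) G ⟩
    y * y ^ suc m + (1# + y * G)   ≈⟨ +-congˡ (sym (eval-geometric-suc p m x)) ⟩
    y ^ suc (suc m) + G′           ∎
    where
    y G G′ : Carrier
    y  = x ^ suc p
    G  = eval (geometric p m) x
    G′ = eval (geometric p (suc m)) x

module FiniteFieldTheory {c ℓ N} (F : FiniteField c ℓ N) where
  open FiniteField F
  open FieldTheory cring isField
  open UniqueSetoid setoid using (Unique)
  open MembershipSetoid setoid using (_∈_)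
  open import Algebra.Properties.Group +-group using (ε⁻¹≈ε; ∙-cancelʳ)
  open import Algebra.Properties.CommutativeSemigroup *-commutativeSemigroup using (x∙yz≈y∙xz)
  open import Relation.Binary.Reasoning.Setoid setoid

  pow≡^ : ∀ x n → pow F x n ≡ x ^ n
  pow≡^ x zero    = ≡.refl
  pow≡^ x (suc n) = ≡.cong (x *_) (pow≡^ x n)

  private
    enumerate : Fin N → Carrier
    enumerate = proj₁ card
    enumerate-injective : ∀ i j → enumerate i ≈ enumerate j → i ≡ j
    enumerate-injective = proj₁ (proj₂ card)
    enumerate-surjective : ∀ x → Σ (Fin N) λ i → enumerate i ≈ x
    enumerate-surjective = proj₂ (proj₂ card)

  infix 4 _≟_
  _≟_ : ∀ x y → Dec (x ≈ y)
  x ≟ y with enumerate-surjective x | enumerate-surjective y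
  ... | i , eᵢ≈x | j , eⱼ≈y with i Fin.≟ j
  ... | yes ≡.refl = yes (trans (sym eᵢ≈x) eⱼ≈y)
  ... | no  i≢j    = no (λ x≈y → i≢j (enumerate-injective i j (trans eᵢ≈x (trans x≈y (sym eⱼ≈y)))))

  elements : List Carrier
  elements = tabulate enumerate

  elements-unique : Unique elements
  elements-unique = Unique.tabulate⁺ setoid (λ {i} {j} → enumerate-injective i j)

  ∈-elements : ∀ x → x ∈ elements
  ∈-elements x with enumerate-surjective x
  ... | i , eᵢ≈x = Membership.∈-resp-≈ setoid eᵢ≈x (Membership.∈-tabulate⁺ setoid i)

  units : List Carrier
  units = filter (∁? (_≟ 0#)) elements

  units-unique : Unique units
  units-unique = Unique.filter⁺ setoid (∁? (_≟ 0#)) elements-unique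

  units-≉0 : All (_≉ 0#) units
  units-≉0 = All.all-filter (∁? (_≟ 0#)) elements

  ∈-units : ∀ {x} → x ≉ 0# → x ∈ units
  ∈-units {x} = Membership.∈-filter⁺ setoid (∁? (_≟ 0#)) (λ x≈y x≉0 y≈0 → x≉0 (trans x≈y y≈0)) (∈-elements x)

  length-units : suc (length units) ≡ N
  length-units = ≡.trans (≡.cong (ℕ._+ length units) (≡.sym length-zeros))
                 (≡.trans (length-filter+length-filter-∁ (_≟ 0#) elements) (List.length-tabulate enumerate))
    where
    zeros : List Carrier
    zeros = filter (_≟ 0#) elements
    0∈zeros : 0# ∈ zeros
    0∈zeros = Membership.∈-filter⁺ setoid (_≟ 0#) (λ x≈y x≈0 → trans (sym x≈y) x≈0) (∈-elements 0#) refl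
    length-zeros : length zeros ≡ 1
    length-zeros with zeros | Unique.filter⁺ setoid (_≟ 0#) elements-unique | All.all-filter (_≟ 0#) elements | 0∈zeros
    ... | _ ∷ []    | _               | _               | _ = ≡.refl
    ... | _ ∷ _ ∷ _ | (u≉v ∷ _) ∷ _ | u≈0 ∷ v≈0 ∷ _ | _ = ⊥-elim (u≉v (trans u≈0 (sym v≈0)))

  fermat : ∀ {b} → b ≉ 0# → b ^ length units ≈ 1#
  fermat {b} b≉0 = *-cancelʳ-≉0 (prod-≉0 units-≉0) (begin
    b ^ length units * prod units   ≈⟨ sym (prod-map-* b units) ⟩
    prod (map (b *_) units)         ≈⟨ prod-unique-⊆ bU-unique bU⊆U (List.length-map (b *_) units) ⟩
    prod units                      ≈⟨ sym (*-identityˡ _) ⟩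
    1# * prod units                 ∎)
    where
    bU-unique : Unique (map (b *_) units)
    bU-unique = Unique.map⁺ setoid setoid (*-cancelˡ-≉0 b≉0) units-unique
    bU⊆U : All (_∈ units) (map (b *_) units)
    bU⊆U = All.map⁺ (All.map (λ u≉0 → ∈-units (*-≉0 b≉0 u≉0)) units-≉0)

  roots-of-unity : ∀ d e → N ≡ suc (d ℕ.* e) →
                   Σ (List Carrier) λ A → Unique A × All (λ a → a ≉ 0# × a ^ d ≈ 1#) A × length A ≡ d
  roots-of-unity zero    e       _   = [] , [] , [] , ≡.refl
  roots-of-unity (suc p) zero    N≡1 = ⊥-elim (ℕ.<⇒≢ (Membership.∈-length setoid (∈-units 1≉0)) (≡.sym length-units≡0))
    where
    length-units≡0 : length units ≡ 0
    length-units≡0 = ≡.trans (ℕ.suc-injective (≡.trans length-units N≡1)) (ℕ.*-zeroʳ (suc p))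
  roots-of-unity (suc p) (suc m) N≡  = take d A , Unique.take⁺ setoid d A-unique , All.take⁺ d A-roots , length-take-d
    where
    d : ℕ
    d = suc p
    P? : Decidable (λ a → a ^ d ≈ 1#)
    P? a = a ^ d ≟ 1#
    A B : List Carrier
    A = filter P? units
    B = filter (∁? P?) units
    A-unique : Unique A
    A-unique = Unique.filter⁺ setoid P? units-unique
    A-roots : All (λ a → a ≉ 0# × a ^ d ≈ 1#) A
    A-roots = All.zip (All.filter⁺ P? units-≉0 , All.all-filter P? units)
    length-units≡ : length units ≡ d ℕ.* suc m
    length-units≡ = ℕ.suc-injective (≡.trans length-units N≡)
    B-roots : All (λ b → eval (geometric p m) b ≈ 0#) B
    B-roots = All.map geometric-root (All.zip (All.filter⁺ (∁? P?) units-≉0 , All.all-filter (∁? P?) units))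
      where
      geometric-root : ∀ {b} → b ≉ 0# × b ^ d ≉ 1# → eval (geometric p m) b ≈ 0#
      geometric-root {b} (b≉0 , y≉1) = xz≈yz∧x≉y⇒z≈0 y≉1 (∙-cancelʳ 1# _ _ (begin
        y * G + 1#     ≈⟨ geometric-sum p m b ⟩
        y ^ suc m + G  ≈⟨ +-congʳ y^[m+1]≈1 ⟩
        1# + G         ≈⟨ +-comm 1# G ⟩
        G + 1#         ≈⟨ +-congʳ (sym (*-identityˡ G)) ⟩
        1# * G + 1#    ∎))
        where
        y G : Carrier
        y = b ^ d
        G = eval (geometric p m) b
        y^[m+1]≈1 : y ^ suc m ≈ 1#
        y^[m+1]≈1 = begin
          (b ^ d) ^ suc m      ≈⟨ ^-assocʳ b d (suc m) ⟩
          b ^ (d ℕ.* suc m)    ≡⟨ ≡.cong (b ^_) (≡.sym length-units≡) ⟩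
          b ^ length units     ≈⟨ fermat b≉0 ⟩
          1#                   ∎
    length-B≤ : length B ≤ d ℕ.* m
    length-B≤ = ≡.subst (length B ≤_) (length-geometric p m)
                  (roots-bound (geometric p m) (Unique.filter⁺ setoid (∁? P?) units-unique) B-roots)
    d≤length-A : d ≤ length A
    d≤length-A = m+n≡o+p∧n≤p⇒o≤m
      (≡.trans (length-filter+length-filter-∁ P? units) (≡.trans length-units≡ (ℕ.*-suc d m))) length-B≤
    length-take-d : length (take d A) ≡ d
    length-take-d = ≡.trans (List.length-take d A) (ℕ.m≤n⇒m⊓n≡m d≤length-A)

  fixed-units : ∀ Q k → N ≡ Q ℕ.^ k →
                Σ (List Carrier) λ A → Unique A × All (λ a → pow F a Q ≈ a × a ≉ 0#) A × length A ≡ Q ℕ.∸ 1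
  fixed-units zero    _ _  = [] , [] , [] , ≡.refl
  fixed-units (suc d) k N≡ with suc^≡suc-* d k
  ... | e , Q^k≡ with roots-of-unity d e (≡.trans N≡ Q^k≡)
  ... | A , A-unique , A-roots , length-A = A , A-unique , All.map fixed A-roots , length-A
    where
    fixed : ∀ {a} → a ≉ 0# × a ^ d ≈ 1# → pow F a (suc d) ≈ a × a ≉ 0#
    fixed {a} (a≉0 , a^d≈1) = trans (reflexive (pow≡^ a (suc d))) (trans (*-congˡ a^d≈1) (*-identityʳ a)) , a≉0

  sumFin-cong : ∀ m {g h : Fin m → Carrier} → (∀ i → g i ≈ h i) → sumFin F m g ≈ sumFin F m h
  sumFin-cong zero    _   = refl
  sumFin-cong (suc m) g≈h = +-cong (g≈h Fin.zero) (sumFin-cong m (λ i → g≈h (Fin.suc i)))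

  sumFin-*ˡ : ∀ m k (g : Fin m → Carrier) → sumFin F m (λ i → k * g i) ≈ k * sumFin F m g
  sumFin-*ˡ zero    k g = sym (zeroʳ k)
  sumFin-*ˡ (suc m) k g = trans (+-congˡ (sumFin-*ˡ m k _)) (sym (distribˡ k _ _))

  ^-fixed : ∀ {x} Q → x ^ Q ≈ x → ∀ i → x ^ (Q ℕ.^ i) ≈ x
  ^-fixed     Q x^Q≈x zero    = *-identityʳ _
  ^-fixed {x} Q x^Q≈x (suc i) = begin
    x ^ (Q ℕ.* Q ℕ.^ i)   ≈⟨ sym (^-assocʳ x Q (Q ℕ.^ i)) ⟩
    (x ^ Q) ^ (Q ℕ.^ i)   ≈⟨ ^-congˡ (Q ℕ.^ i) x^Q≈x ⟩
    x ^ (Q ℕ.^ i)         ≈⟨ ^-fixed Q x^Q≈x i ⟩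
    x                     ∎

  linPoly-semilinear : ∀ q t t' s coeffs {a} → pow F a (q ℕ.^ t) ≈ a → ∀ x →
    linPoly F q t t' s coeffs (a * x) ≈ pow F a (q ℕ.^ s) * linPoly F q t t' s coeffs x
  linPoly-semilinear q t t' s coeffs {a} a^Q≈a x =
    trans (sumFin-cong t' term) (sumFin-*ˡ t' (pow F a (q ℕ.^ s)) _)
    where
    a^q^t≈a : a ^ (q ℕ.^ t) ≈ a
    a^q^t≈a = trans (reflexive (≡.sym (pow≡^ a (q ℕ.^ t)))) a^Q≈a
    exponent : ∀ i → q ℕ.^ (i ℕ.* t ℕ.+ s) ≡ (q ℕ.^ t) ℕ.^ i ℕ.* q ℕ.^ s
    exponent i = ≡.trans (ℕ.^-distribˡ-+-* q (i ℕ.* t) s)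
                         (≡.cong (ℕ._* q ℕ.^ s) (≡.trans (≡.cong (q ℕ.^_) (ℕ.*-comm i t)) (≡.sym (ℕ.^-*-assoc q t i))))
    term : ∀ i → let K = q ℕ.^ (Fin.toℕ i ℕ.* t ℕ.+ s) in
           coeffs i * pow F (a * x) K ≈ pow F a (q ℕ.^ s) * (coeffs i * pow F x K)
    term i = begin
      coeffs i * pow F (a * x) K          ≈⟨ *-congˡ (reflexive (pow≡^ (a * x) K)) ⟩
      coeffs i * (a * x) ^ K              ≈⟨ *-congˡ (^-distrib-* a x K) ⟩
      coeffs i * (a ^ K * x ^ K)          ≈⟨ *-congˡ (*-congʳ a^K≈a^q^s) ⟩
      coeffs i * (a ^ (q ℕ.^ s) * x ^ K)  ≈⟨ x∙yz≈y∙xz (coeffs i) _ _ ⟩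
      a ^ (q ℕ.^ s) * (coeffs i * x ^ K)  ≈⟨ reflexive (≡.sym (≡.cong₂ (λ u v → u * (coeffs i * v)) (pow≡^ a (q ℕ.^ s)) (pow≡^ x K))) ⟩
      pow F a (q ℕ.^ s) * (coeffs i * pow F x K) ∎
      where
      K : ℕ
      K = q ℕ.^ (Fin.toℕ i ℕ.* t ℕ.+ s)
      a^K≈a^q^s : a ^ K ≈ a ^ (q ℕ.^ s)
      a^K≈a^q^s = begin
        a ^ K                                       ≡⟨ ≡.cong (a ^_) (exponent (Fin.toℕ i)) ⟩
        a ^ ((q ℕ.^ t) ℕ.^ Fin.toℕ i ℕ.* q ℕ.^ s)   ≈⟨ sym (^-assocʳ a ((q ℕ.^ t) ℕ.^ Fin.toℕ i) (q ℕ.^ s)) ⟩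
        (a ^ (q ℕ.^ t) ℕ.^ Fin.toℕ i) ^ (q ℕ.^ s)   ≈⟨ ^-congˡ (q ℕ.^ s) (^-fixed (q ℕ.^ t) a^q^t≈a (Fin.toℕ i)) ⟩
        a ^ (q ℕ.^ s)                               ∎

  diag-∈G : ∀ {f a b} → a * b ≉ 0# → (∀ x → f (a * x) ≈ b * f x) → InG F f (diag F a b)
  diag-∈G {f} {a} {b} ab≉0 f-semilinear = det≉0 , λ x → a * x , first-row x , second-row x
    where
    det≉0 : det F (diag F a b) ≉ 0#
    det≉0 det≈0 = ab≉0 (begin
      a * b                ≈⟨ sym (+-identityʳ _) ⟩
      a * b + 0#           ≈⟨ +-congˡ (sym ε⁻¹≈ε) ⟩
      a * b - 0#           ≈⟨ +-congˡ (-‿cong (sym (zeroˡ 0#))) ⟩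
      a * b - 0# * 0#      ≈⟨ det≈0 ⟩
      0#                   ∎)
    first-row : ∀ x → a * x + 0# * f x ≈ a * x
    first-row x = trans (+-congˡ (zeroˡ _)) (+-identityʳ _)
    second-row : ∀ x → 0# * x + b * f x ≈ f (a * x)
    second-row x = trans (trans (+-congʳ (zeroˡ x)) (+-identityˡ _)) (sym (f-semilinear x))

open import Data.Nat using (_*_; _^_; _∸_)

proposition7p4 : ∀ {c ℓ} (q n t t' s : ℕ) → IsPrimePower q → n ≡ t * t' → gcd s t ≡ 1
    → (F : FiniteField c ℓ (q ^ n)) → (coeffs : Fin t' → FiniteField.Carrier F)
    → (∀ a → FiniteField._≈_ F (pow F a (q ^ t)) a → ¬ (FiniteField._≈_ F a (FiniteField.0# F))
         → InG F (linPoly F q t t' s coeffs) (diag F a (pow F a (q ^ s))))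
      × AtLeastInG F (linPoly F q t t' s coeffs) (q ^ t ∸ 1)
proposition7p4 q n t t' s _ n≡tt' _ F coeffs = diagonal-∈G , at-least
  where
  open FiniteField F
  open FieldTheory cring isField using (*-≉0; ^-≉0)
  open FiniteFieldTheory F

  diagonal-∈G : ∀ a → pow F a (q ^ t) ≈ a → a ≉ 0# → InG F (linPoly F q t t' s coeffs) (diag F a (pow F a (q ^ s)))
  diagonal-∈G a a^Q≈a a≉0 = diag-∈G (*-≉0 a≉0 pow≉0) (linPoly-semilinear q t t' s coeffs a^Q≈a)
    where
    pow≉0 : pow F a (q ^ s) ≉ 0#
    pow≉0 rewrite pow≡^ a (q ^ s) = ^-≉0 (q ^ s) a≉0

  at-least : AtLeastInG F (linPoly F q t t' s coeffs) (q ^ t ∸ 1)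
  at-least with fixed-units (q ^ t) t' (≡.trans (≡.cong (q ^_) n≡tt') (≡.sym (ℕ.^-*-assoc q t t')))
  ... | A , A-unique , A-fixed , length-A =
    map diagonal A , ≡.trans (List.length-map diagonal A) length-A
    , AllPairs.map⁺ (AllPairs.map (λ a≉b a≈b → a≉b (proj₁ a≈b)) A-unique)
    , All.map⁺ (All.map (λ (a^Q≈a , a≉0) → diagonal-∈G _ a^Q≈a a≉0) A-fixed)
    where
    diagonal : Carrier → M2 F
    diagonal a = diag F a (pow F a (q ^ s))
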